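{- If $X_i=\mathbf{0}$ for some integer $i$, then there is no link between $X_{i+f}$ and $X_{i-1}$ in the decoration of $X$.
   Context: Let $p$ be a prime, $f\ge2$, $q=p^f$, $e=p^f-1$, $\nu=p+\dots+p^{f-1}$. Let $h$ be an integer not divisible by $q+1$, $\gamma'\in\mathbb{Z}/e\mathbb{Z}$. Let $h_0,\dots,h_{f-1}\in[\![0,p-1]\!]$ with $h\equiv1+\sum_{i=0}^{f-1}h_ip^{f-1-i}\pmod{q+1}$, $h_i=p-1-h_{i-f}$ for $f\le i<2f$, extended $2f$-periodically; $\varepsilon_i=1$ if $h_i=p-1$, else $0$. Let $\alpha_i\in[\![0,e-1]\!]$ with $\alpha_i\equiv\lfloor p^ih/(q+1)\rfloor-p^i\gamma'\pmod e$ (extended $2f$-periodically). $X_i=\mathbf{A}$ if $0\le\alpha_i<\nu/p+\varepsilon_{i+f}$; $\mathbf{AB}$ if $\nu/p+\varepsilon_{i+f}\le\alpha_i\le\frac{p-1}{p}\nu-\varepsilon_i$; $\mathbf{B}$ if $\frac{p-1}{p}\nu-\varepsilon_i<\alpha_i\le\nu$; $\mathbf{0}$ if $\alpha_i>\nu$. Indices of $X$ are mod $2f$. Dominance: $X$ has a dominant character if some $i_0\in[\![0,f-1]\!]$ has $(X_{i_0},X_{i_0+f})\notin\{(\mathbf{0},\mathbf{0}),(\mathbf{0},\mathbf{AB}),(\mathbf{AB},\mathbf{0}),(\mathbf{AB},\mathbf{AB}),(\mathbf{A},\mathbf{B}),(\mathbf{B},\mathbf{A})\}$; then for $i=i_0,i_0-1,\dots,0,f-1,\dots,i_0+1$: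 $\mathbf{A}$ is dominant at $i$ if $(X_i,X_{i+f})\in\{(\mathbf{A},\mathbf{AB}),(\mathbf{AB},\mathbf{A}),(\mathbf{A},\mathbf{A}),(\mathbf{A},\mathbf{0}),(\mathbf{0},\mathbf{A})\}$; $\mathbf{B}$ is dominant if $(X_i,X_{i+f})\in\{(\mathbf{B},\mathbf{AB}),(\mathbf{AB},\mathbf{B}),(\mathbf{B},\mathbf{B}),(\mathbf{B},\mathbf{0}),(\mathbf{0},\mathbf{B})\}$; otherwise the allele dominant at $i+1$ (mod $f$) is dominant at $i$. Decoration: if $X$ has a dominant character, for each $i\in[\![0,f-1]\!]$ with the same $Y\in\{\mathbf{A},\mathbf{B}\}$ dominant at $i$ and $i+1$ (mod $f$), link $X_i$ and $X_{i+1+f}$ if $X_i=Y$, and link $X_{i+f}$ and $X_{i+1}$ if $X_{i+f}=Y$. If $X$ has no dominant character, there are no links. -}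

module Defs where

open import Data.Nat as ℕ using (ℕ; zero; suc; _∸_; _^_; _<ᵇ_; _≤ᵇ_; _≡ᵇ_; _%_)
open import Data.Integer as ℤ using (ℤ; +_; _%ℕ_)
open import Data.Bool using (Bool; true; false; if_then_else_)
open import Data.Maybe using (Maybe; just; nothing)
open import Data.Product using (Σ; _×_; ∃-syntax)
open import Data.Sum using (_⊎_)
open import Relation.Binary.PropositionalEquality using (_≡_)
open import Relation.Nullary using (¬_)

modN : ℕ → ℕ → ℕ
modN a zero    = a
modN a (suc n) = a % suc n

modZ : ℤ → ℕ → ℕ
modZ z zero    = 0
modZ z (suc n) = z %ℕ suc n

sumTo : ℕ → (ℕ → ℕ) → ℕ
sumTo zero    g = 0
sumTo (suc n) g = sumTo n g ℕ.+ g n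

-- The values of X_i : A, AB, B, 0 (written O)
data Allele : Set where
  A AB B O : Allele

-- Classification of a pair (X_i , X_{i+f}) for the dominance rule:
-- neut = the six pairs listed as excluded for i₀ (no allele dominant at i by itself),
-- clsA / clsB = the pairs for which A / B is dominant at i.
data Cls : Set where
  neut clsA clsB : Cls

cls : Allele → Allele → Cls
cls O  O  = neut
cls O  AB = neut
cls AB O  = neut
cls AB AB = neut
cls A  B  = neut
cls B  A  = neut
cls A  AB = clsA
cls AB A  = clsA
cls A  A  = clsA
cls A  O  = clsA
cls O  A  = clsA
cls B  AB = clsB
cls AB B  = clsB
cls B  B  = clsB
cls B  O  = clsB
cls O  B  = clsB

-- The whole construction, given p, f, the digits h_0..h_{f-1} (hd i for i < f)
-- and the numbers α_0..α_{2f-1} (α i for i < 2f).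
module Construction (p f : ℕ) (hd : ℕ → ℕ) (α : ℕ → ℕ) where

  idx : ℕ → ℕ
  idx j = modN j (f ℕ.+ f)

  idxℤ : ℤ → ℕ
  idxℤ z = modZ z (f ℕ.+ f)

  hh : ℕ → ℕ
  hh j = if idx j <ᵇ f then hd (idx j) else (p ∸ 1) ∸ hd (idx j ∸ f)

  ε : ℕ → ℕ
  ε j = if hh j ≡ᵇ (p ∸ 1) then 1 else 0

  αx : ℕ → ℕ
  αx j = α (idx j)

  -- ν = p + p^2 + ... + p^{f-1}
  ν : ℕ
  ν = sumTo f (λ k → p ^ k) ∸ 1

  -- The bounds ν/p + ε_{i+f} and ((p-1)/p)ν - ε_i are compared after
  -- multiplying everything by p (exact, since p > 0):
  --   A  : p α < ν + p ε_{i+f}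
  --   AB : ν + p ε_{i+f} ≤ p α  and  p α + p ε_i ≤ (p-1) ν
  --   B  : (p-1) ν < p α + p ε_i  and  α ≤ ν
  --   0  : α > ν
  -- (the four conditions are mutually exclusive, hence the if-chain)
  X : ℕ → Allele
  X j =
    if p ℕ.* αx j <ᵇ ν ℕ.+ p ℕ.* ε (j ℕ.+ f) then A
    else if p ℕ.* αx j ℕ.+ p ℕ.* ε j ≤ᵇ (p ∸ 1) ℕ.* ν then AB
    else if αx j ≤ᵇ ν then B
    else O

  pairCls : ℕ → Cls
  pairCls i = cls (X i) (X (i ℕ.+ f))

  HasDominant : Set
  HasDominant = Σ ℕ λ i₀ → (i₀ ℕ.< f) × ¬ (pairCls i₀ ≡ neut)

  -- Unfolding of the backward recursion: the allele dominant at i is the one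
  -- determined by the first non-neutral pair among i, i+1, ..., (mod f).
  domSearch : ℕ → ℕ → Maybe Allele
  domSearch zero    i = nothing
  domSearch (suc k) i with pairCls i
  ... | clsA = just A
  ... | clsB = just B
  ... | neut = domSearch k (modN (suc i) f)

  -- dominant allele at i (i taken mod f); `nothing` iff no dominant character
  dom : ℕ → Maybe Allele
  dom i = domSearch f (modN i f)

  SamePair : ℤ → ℤ → ℕ → ℕ → Set
  SamePair a b u v =
    (idxℤ a ≡ idx u × idxℤ b ≡ idx v) ⊎ (idxℤ a ≡ idx v × idxℤ b ≡ idx u)

  Linked : ℤ → ℤ → Set
  Linked a b =
    HasDominant ×
    (Σ ℕ λ i → (i ℕ.< f) × ∃[ Y ]
       (dom i ≡ just Y × dom (modN (suc i) f) ≡ just Y ×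
        ((X i ≡ Y × SamePair a b i (suc i ℕ.+ f))
         ⊎ (X (i ℕ.+ f) ≡ Y × SamePair a b (i ℕ.+ f) (suc i)))))

module Submission where

-- A link joins positions j and j + 1 + f (mod 2f) where X_j equals the allele dominant
-- at j, which is A or B.  For the pair {i + f, i − 1} only j ≡ i − 1 is possible (the
-- other orientation would force 2f ∣ 2), so it suffices to show that an entry 0 is never
-- preceded by an entry A or B.  Writing h = 1 + S + t (q + 1) with
-- S = (h_0 … h_{f−1})_p, one has ⌊p^j h/(q + 1)⌋ = (h_0 … h_{j−1})_p + p^j t for j ≤ 2f,
-- because (1 + S)/(q + 1) = D/(p^{2f} − 1) for the 2f-digit period D of the expansion.
-- This gives the recursion α_{k+1} ≡ p α_k + h_k (mod e) for all k (mod 2f), and with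
-- ν < α_{k+1} < e and h_k + h_{k+f} = p − 1 a short estimate excludes X_k ∈ {A, B}.

open import Defs
open import Data.Nat as ℕ using (ℕ; zero; suc; _+_; _*_; _∸_; _^_; _≤_; _<_; z≤n; s≤s; z<s; NonZero; _<ᵇ_; _≡ᵇ_; nonTrivial⇒n>1)
open import Data.Nat.Properties
open import Data.Nat.DivMod using (_/_; _%_; m≡m%n+[m/n]*n; m%n<n; +-distrib-/-∣ʳ; m<n⇒m/n≡0; m*n/n≡m; m*n/o*n≡m/o; /-congˡ; [m+n]%n≡m%n; m<n⇒m%n≡m)
import Data.Nat.Divisibility as ℕ∣
open import Data.Nat.Primality using (Prime; prime⇒nonTrivial)
import Data.Nat.Tactic.RingSolver as ℕ-Ring
open import Data.Integer as ℤ using (ℤ; +_; _-_; _/ℕ_)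
open import Data.Integer.DivMod using (_%ℕ_; n%ℕd<d; a≡a%ℕn+[a/ℕn]*n)
import Data.Integer.Properties as ℤP
open import Data.Integer.Divisibility using (_∣_)
open import Data.Integer.Divisibility.Signed using (divides; ∣⇒∣ᵤ; ∣ᵤ⇒∣; ∣m∣n⇒∣m+n; ∣m∣n⇒∣m-n; ∣n⇒∣m*n; ∣m+n∣n⇒∣m) renaming (_∣_ to _∣ₛ_)
import Data.Integer.Tactic.RingSolver as ℤ-Ring
open import Data.Bool using (Bool; true; false; if_then_else_; T)
open import Data.Unit using (tt)
open import Data.Empty using (⊥; ⊥-elim)
open import Data.Maybe using (just)
open import Data.Product using (Σ; _×_; _,_; proj₁; proj₂; ∃-syntax)
open import Data.Sum using (_⊎_; inj₁; inj₂)
open import Relation.Binary.PropositionalEquality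
open import Relation.Nullary using (¬_; contradiction; yes; no)
open import Algebra.Bundles using (AbelianGroup)
open import Algebra.Properties.Group (AbelianGroup.group ℤP.+-0-abelianGroup) using () renaming (∙-cancelˡ to ℤ+-cancelˡ)

residue-unique : ∀ {d a b} → a < d → b < d → + d ∣ₛ (+ a ℤ.- + b) → a ≡ b
residue-unique {d} {a} {b} a<d b<d d∣a-b =
  ℤP.+-injective (ℤP.i-j≡0⇒i≡j (+ a) (+ b) (ℤP.∣i∣≡0⇒i≡0 ∣a-b∣≡0))
  where
  ∣a-b∣<d : ℤ.∣ + a ℤ.- + b ∣ < d
  ∣a-b∣<d = subst (_< d) (sym (cong ℤ.∣_∣ (ℤP.m-n≡m⊖n a b)))
              (≤-<-trans (ℤP.∣m⊝n∣≤m⊔n a b) (⊔-lub a<d b<d))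
  ∣a-b∣≡0 : ℤ.∣ + a ℤ.- + b ∣ ≡ 0
  ∣a-b∣≡0 with ℤ.∣ + a ℤ.- + b ∣ in eq
  ... | zero  = refl
  ... | suc _ = ⊥-elim (<⇒≱ (subst (_< d) eq ∣a-b∣<d)
                             (ℕ∣.∣⇒≤ (subst (ℕ∣._∣_ d) eq (∣⇒∣ᵤ d∣a-b))))

divmod-unique : ∀ d .{{_ : NonZero d}} x r c → r < d → x ≡ + r ℤ.+ c ℤ.* + d →
                x %ℕ d ≡ r × x /ℕ d ≡ c
divmod-unique d x r c r<d x≡ = sym r≡r′ , ℤP.*-cancelʳ-≡ c′ c (+ d) c′d≡cd
  where
  r′ = x %ℕ d
  c′ = x /ℕ d
  x≡′ : x ≡ + r′ ℤ.+ c′ ℤ.* + d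
  x≡′ = a≡a%ℕn+[a/ℕn]*n x d
  r-r′ : + r ℤ.- + r′ ≡ (c′ ℤ.- c) ℤ.* + d
  r-r′ = begin
    + r ℤ.- + r′                                                      ≡⟨ regroup (+ r) (+ r′) c c′ (+ d) ⟩
    ((+ r ℤ.+ c ℤ.* + d) ℤ.- (+ r′ ℤ.+ c′ ℤ.* + d)) ℤ.+ (c′ ℤ.- c) ℤ.* + d ≡⟨ cong₂ (λ y z → (y ℤ.- z) ℤ.+ (c′ ℤ.- c) ℤ.* + d) (sym x≡) (sym x≡′) ⟩
    (x ℤ.- x) ℤ.+ (c′ ℤ.- c) ℤ.* + d                                   ≡⟨ cong (ℤ._+ (c′ ℤ.- c) ℤ.* + d) (ℤP.+-inverseʳ x) ⟩
    + 0 ℤ.+ (c′ ℤ.- c) ℤ.* + d                                         ≡⟨ ℤP.+-identityˡ _ ⟩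
    (c′ ℤ.- c) ℤ.* + d                                                ∎
    where
    open ≡-Reasoning
    regroup : ∀ r r′ c c′ d → r ℤ.- r′ ≡ ((r ℤ.+ c ℤ.* d) ℤ.- (r′ ℤ.+ c′ ℤ.* d)) ℤ.+ (c′ ℤ.- c) ℤ.* d
    regroup = ℤ-Ring.solve-∀
  r≡r′ : r ≡ r′
  r≡r′ = residue-unique r<d (n%ℕd<d x d) (divides (c′ ℤ.- c) r-r′)
  c′d≡cd : c′ ℤ.* + d ≡ c ℤ.* + d
  c′d≡cd = ℤ+-cancelˡ (+ r) (c′ ℤ.* + d) (c ℤ.* + d)
             (trans (cong (λ z → + z ℤ.+ c′ ℤ.* + d) r≡r′) (trans (sym x≡′) x≡))

euclid-ℤ : ∀ u d .{{_ : NonZero d}} → + u ≡ + (u % d) ℤ.+ + (u / d) ℤ.* + d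
euclid-ℤ u d = trans (cong +_ (m≡m%n+[m/n]*n u d))
                 (trans (ℤP.pos-+ (u % d) (u / d * d)) (cong (λ z → + (u % d) ℤ.+ z) (ℤP.pos-* (u / d) d)))

module _ (d : ℕ) .{{_ : NonZero d}} where

  same-residue⇒∣ : ∀ x u → x %ℕ d ≡ u % d → + d ∣ₛ x ℤ.- + u
  same-residue⇒∣ x u r≡ = divides (x /ℕ d ℤ.- + (u / d)) (begin
    x ℤ.- + u                                                           ≡⟨ cong₂ ℤ._-_ (a≡a%ℕn+[a/ℕn]*n x d) (euclid-ℤ u d) ⟩
    (+ (x %ℕ d) ℤ.+ x /ℕ d ℤ.* + d) ℤ.- (+ (u % d) ℤ.+ + (u / d) ℤ.* + d) ≡⟨ cong (λ r → (+ r ℤ.+ x /ℕ d ℤ.* + d) ℤ.- (+ (u % d) ℤ.+ + (u / d) ℤ.* + d)) r≡ ⟩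
    (+ (u % d) ℤ.+ x /ℕ d ℤ.* + d) ℤ.- (+ (u % d) ℤ.+ + (u / d) ℤ.* + d)  ≡⟨ cancel (+ (u % d)) (x /ℕ d) (+ (u / d)) (+ d) ⟩
    (x /ℕ d ℤ.- + (u / d)) ℤ.* + d                                      ∎)
    where
    open ≡-Reasoning
    cancel : ∀ r a b d → (r ℤ.+ a ℤ.* d) ℤ.- (r ℤ.+ b ℤ.* d) ≡ (a ℤ.- b) ℤ.* d
    cancel = ℤ-Ring.solve-∀

  ∣⇒same-residue : ∀ x u → + d ∣ₛ x ℤ.- + u → x %ℕ d ≡ u % d
  ∣⇒same-residue x u (divides c x-u≡) = proj₁ (divmod-unique d x (u % d) (+ (u / d) ℤ.+ c) (m%n<n u d) (begin
    x                                                ≡⟨ unshift x (+ u) ⟩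
    + u ℤ.+ (x ℤ.- + u)                              ≡⟨ cong₂ ℤ._+_ (euclid-ℤ u d) x-u≡ ⟩
    + (u % d) ℤ.+ + (u / d) ℤ.* + d ℤ.+ c ℤ.* + d     ≡⟨ collect (+ (u % d)) (+ (u / d)) c (+ d) ⟩
    + (u % d) ℤ.+ (+ (u / d) ℤ.+ c) ℤ.* + d          ∎))
    where
    open ≡-Reasoning
    unshift : ∀ x u → x ≡ u ℤ.+ (x ℤ.- u)
    unshift = ℤ-Ring.solve-∀
    collect : ∀ r a c d → r ℤ.+ a ℤ.* d ℤ.+ c ℤ.* d ≡ r ℤ.+ (a ℤ.+ c) ℤ.* d
    collect = ℤ-Ring.solve-∀

congruent-above : ∀ {e b x} .{{_ : NonZero e}} → b < e → + e ∣ₛ (+ b ℤ.- + x) → ∃[ m ] x ≡ b + m * e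
congruent-above {e} {b} {x} b<e e∣b-x = x / e , (begin
  x                   ≡⟨ m≡m%n+[m/n]*n x e ⟩
  x % e + x / e * e   ≡⟨ cong (_+ x / e * e) (∣⇒same-residue e (+ b) x e∣b-x) ⟨
  b % e + x / e * e   ≡⟨ cong (_+ x / e * e) (m<n⇒m%n≡m b<e) ⟩
  b + x / e * e       ∎)
  where open ≡-Reasoning

quotient-unique : ∀ {d} .{{_ : NonZero d}} r k → r < d → (r + k * d) / d ≡ k
quotient-unique {d} r k r<d = begin
  (r + k * d) / d     ≡⟨ +-distrib-/-∣ʳ r (ℕ∣.n∣m*n k) ⟩
  r / d + k * d / d   ≡⟨ cong₂ _+_ (m<n⇒m/n≡0 r<d) (m*n/n≡m k d) ⟩
  k                   ∎
  where open ≡-Reasoning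

swap-not-max : ∀ {x y P L} → P < x → L < y → suc (P * y + L) < x * y → suc (P + x * L) < x * y
swap-not-max {x} {y} {P} {L} P<x L<y lt with m≤n⇒∃[o]m+o≡n P<x | m≤n⇒∃[o]m+o≡n L<y
... | a , refl | b , refl = subst (suc (P + (suc P + a) * L) <_) (sym (swapped P a L b)) (m<m+n _ a+xb>0)
  where
  original : ∀ P a L b → (suc P + a) * (suc L + b) ≡ suc (P * (suc L + b) + L) + (a * (suc L + b) + b)
  original = ℕ-Ring.solve-∀
  swapped : ∀ P a L b → (suc P + a) * (suc L + b) ≡ suc (P + (suc P + a) * L) + (a + (suc P + a) * b)
  swapped = ℕ-Ring.solve-∀
  ay+b>0 : 0 < a * (suc L + b) + b
  ay+b>0 = +-cancelˡ-< (suc (P * (suc L + b) + L)) 0 (a * (suc L + b) + b)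
             (subst₂ _<_ (sym (+-identityʳ _)) (original P a L b) lt)
  a+xb>0 : 0 < a + (suc P + a) * b
  a+xb>0 = positive a b ay+b>0
    where
    positive : ∀ a b → 0 < a * (suc L + b) + b → 0 < a + (suc P + a) * b
    positive (suc _) _       _ = s≤s z≤n
    positive zero    (suc _) _ = s≤s z≤n
    positive zero    zero    h = ⊥-elim (<-irrefl refl h)

shift-congruence : ∀ {e a′ b′ a b d} p → e ∣ₛ a′ ℤ.- b′ → e ∣ₛ a ℤ.- b → e ∣ₛ b′ ℤ.- (p ℤ.* b ℤ.+ d) →
                   e ∣ₛ a′ ℤ.- (p ℤ.* a ℤ.+ d)
shift-congruence {a′ = a′} {b′} {a} {b} {d} p e∣a′-b′ e∣a-b e∣b′-pb-d =
  subst (_ ∣ₛ_) (sym (regroup a′ b′ a b d p)) (∣m∣n⇒∣m+n (∣m∣n⇒∣m-n e∣a′-b′ (∣n⇒∣m*n p e∣a-b)) e∣b′-pb-d)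
  where
  regroup : ∀ a′ b′ a b d p → a′ ℤ.- (p ℤ.* a ℤ.+ d) ≡ (a′ ℤ.- b′) ℤ.- p ℤ.* (a ℤ.- b) ℤ.+ (b′ ℤ.- (p ℤ.* b ℤ.+ d))
  regroup = ℤ-Ring.solve-∀

module Numeral (p : ℕ) where

  numeral : (ℕ → ℕ) → ℕ → ℕ
  numeral g zero    = 0
  numeral g (suc m) = numeral g m * p + g m

  numeral-cong : ∀ {g g′} m → (∀ i → i < m → g i ≡ g′ i) → numeral g m ≡ numeral g′ m
  numeral-cong zero    _   = refl
  numeral-cong (suc m) g≡g′ =
    cong₂ (λ x y → x * p + y) (numeral-cong m (λ i i<m → g≡g′ i (m<n⇒m<1+n i<m))) (g≡g′ m ≤-refl)

  numeral-split : ∀ g k m → numeral g (k + m) ≡ numeral g k * p ^ m + numeral (λ i → g (k + i)) m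
  numeral-split g k zero = trans (cong (numeral g) (+-identityʳ k)) (sym (trans (+-identityʳ _) (*-identityʳ _)))
  numeral-split g k (suc m) = begin
    numeral g (k + suc m)                                     ≡⟨ cong (numeral g) (+-suc k m) ⟩
    numeral g (k + m) * p + g (k + m)                         ≡⟨ cong (λ x → x * p + g (k + m)) (numeral-split g k m) ⟩
    (numeral g k * p ^ m + numeral g′ m) * p + g (k + m)       ≡⟨ regroup (numeral g k) (p ^ m) (numeral g′ m) p (g (k + m)) ⟩
    numeral g k * (p * p ^ m) + (numeral g′ m * p + g (k + m)) ∎
    where
    open ≡-Reasoning
    g′ : ℕ → ℕ
    g′ i = g (k + i)
    regroup : ∀ a b c d x → (a * b + c) * d + x ≡ a * (d * b) + (c * d + x)
    regroup = ℕ-Ring.solve-∀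

  numeral-bound : ∀ g m → (∀ i → i < m → g i < p) → numeral g m < p ^ m
  numeral-bound g zero    _      = s≤s z≤n
  numeral-bound g (suc m) digits = begin
    suc (numeral g m * p + g m) ≡⟨ +-suc (numeral g m * p) (g m) ⟨
    numeral g m * p + suc (g m) ≤⟨ +-monoʳ-≤ (numeral g m * p) (digits m ≤-refl) ⟩
    numeral g m * p + p         ≡⟨ +-comm (numeral g m * p) p ⟩
    suc (numeral g m) * p       ≤⟨ *-monoˡ-≤ p (numeral-bound g m (λ i i<m → digits i (m<n⇒m<1+n i<m))) ⟩
    p ^ m * p                   ≡⟨ *-comm (p ^ m) p ⟩
    p ^ suc m                   ∎
    where open ≤-Reasoning

  numeral-complement : ∀ g g′ m → (∀ i → i < m → suc (g i + g′ i) ≡ p) →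
                       suc (numeral g m + numeral g′ m) ≡ p ^ m
  numeral-complement g g′ zero    _           = refl
  numeral-complement g g′ (suc m) complementary = begin
    suc (numeral g m * p + g m + (numeral g′ m * p + g′ m)) ≡⟨ regroup (numeral g m) (numeral g′ m) (g m) (g′ m) p ⟩
    (numeral g m + numeral g′ m) * p + suc (g m + g′ m)     ≡⟨ cong (λ x → (numeral g m + numeral g′ m) * p + x) (complementary m ≤-refl) ⟩
    (numeral g m + numeral g′ m) * p + p                    ≡⟨ +-comm _ p ⟩
    suc (numeral g m + numeral g′ m) * p                    ≡⟨ cong (_* p) (numeral-complement g g′ m (λ i i<m → complementary i (m<n⇒m<1+n i<m))) ⟩
    p ^ m * p                                               ≡⟨ *-comm (p ^ m) p ⟩
    p ^ suc m                                               ∎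
    where
    open ≡-Reasoning
    regroup : ∀ a b x y q → suc (a * q + x + (b * q + y)) ≡ (a + b) * q + suc (x + y)
    regroup = ℕ-Ring.solve-∀

  numeral-as-sum : ∀ g f k → k ≤ f →
                   sumTo k (λ i → g i * p ^ (f ∸ 1 ∸ i)) ≡ numeral g k * p ^ (f ∸ k)
  numeral-as-sum g f zero    _   = sym (*-zeroˡ (p ^ f))
  numeral-as-sum g f (suc k) k<f = begin
    sumTo k term + g k * p ^ (f ∸ 1 ∸ k)         ≡⟨ cong₂ _+_ (numeral-as-sum g f k (<⇒≤ k<f)) (cong (λ x → g k * p ^ x) (∸-+-assoc f 1 k)) ⟩
    numeral g k * p ^ (f ∸ k) + g k * p ^ r       ≡⟨ cong (λ x → numeral g k * p ^ x + g k * p ^ r) (+-∸-assoc 1 k<f) ⟩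
    numeral g k * (p * p ^ r) + g k * p ^ r       ≡⟨ regroup (numeral g k) p (p ^ r) (g k) ⟩
    (numeral g k * p + g k) * p ^ r               ∎
    where
    open ≡-Reasoning
    r = f ∸ suc k
    term : ℕ → ℕ
    term i = g i * p ^ (f ∸ 1 ∸ i)
    regroup : ∀ a b c d → a * (b * c) + d * c ≡ (a * b + d) * c
    regroup = ℕ-Ring.solve-∀

module Geometric (p₁ : ℕ) where
  private
    p = suc p₁

  sumTo-shift : ∀ k → sumTo (suc k) (p ^_) ≡ suc (p * sumTo k (p ^_))
  sumTo-shift zero    = cong suc (sym (*-zeroʳ p))
  sumTo-shift (suc k) = trans (cong (_+ p ^ suc k) (sumTo-shift k)) (sym (cong suc (*-distribˡ-+ p (sumTo k (p ^_)) (p ^ k))))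

  geometric : ∀ k → suc (p₁ * sumTo k (p ^_)) ≡ p ^ k
  geometric zero    = cong suc (*-zeroʳ p₁)
  geometric (suc k) = begin
    suc (p₁ * (sumTo k (p ^_) + p ^ k))        ≡⟨ cong suc (*-distribˡ-+ p₁ (sumTo k (p ^_)) (p ^ k)) ⟩
    suc (p₁ * sumTo k (p ^_)) + p₁ * p ^ k     ≡⟨ cong (_+ p₁ * p ^ k) (geometric k) ⟩
    p ^ k + p₁ * p ^ k                         ∎
    where open ≡-Reasoning

if-cases : ∀ {a} {A : Set a} b {x y : A} →
           (T b × (if b then x else y) ≡ x) ⊎ (¬ T b × (if b then x else y) ≡ y)
if-cases true  = inj₁ (tt , refl)
if-cases false = inj₂ ((λ ()) , refl)

classify : Bool → Bool → Bool → Allele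
classify b₁ b₂ b₃ = if b₁ then A else if b₂ then AB else if b₃ then B else O

classify-O : ∀ b₁ b₂ b₃ → classify b₁ b₂ b₃ ≡ O → ¬ T b₃
classify-O true  _     _     ()
classify-O false true  _     ()
classify-O false false true  ()
classify-O false false false _ = λ ()

classify-A : ∀ b₁ b₂ b₃ → classify b₁ b₂ b₃ ≡ A → T b₁
classify-A true  _     _     _ = tt
classify-A false true  _     ()
classify-A false false true  ()
classify-A false false false ()

classify-B : ∀ b₁ b₂ b₃ → classify b₁ b₂ b₃ ≡ B → ¬ T b₂ × T b₃
classify-B true  _     _     ()
classify-B false true  _     ()
classify-B false false true  _ = (λ ()) , tt
classify-B false false false ()

module Shapes (p f : ℕ) (hd α : ℕ → ℕ) where
  open Construction p f hd α

  testA testAB testB : ℕ → Bool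
  testA  j = p * αx j ℕ.<ᵇ ν + p * ε (j + f)
  testAB j = p * αx j + p * ε j ℕ.≤ᵇ (p ∸ 1) * ν
  testB  j = αx j ℕ.≤ᵇ ν

  X≡O⇒ : ∀ j → X j ≡ O → ν < αx j
  X≡O⇒ j eq = ≰⇒> (λ le → classify-O (testA j) (testAB j) (testB j) eq (≤⇒≤ᵇ le))

  X≡A⇒ : ∀ j → X j ≡ A → p * αx j < ν + p * ε (j + f)
  X≡A⇒ j eq = <ᵇ⇒< _ _ (classify-A (testA j) (testAB j) (testB j) eq)

  X≡B⇒ : ∀ j → X j ≡ B → (p ∸ 1) * ν < p * αx j + p * ε j × αx j ≤ ν
  X≡B⇒ j eq with classify-B (testA j) (testAB j) (testB j) eq
  ... | ¬AB , B? = ≰⇒> (λ le → ¬AB (≤⇒≤ᵇ le)) , ≤ᵇ⇒≤ _ _ B?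

  ε-cases : ∀ j → ε j ≡ 0 ⊎ (ε j ≡ 1 × hh j ≡ p ∸ 1)
  ε-cases j with if-cases (hh j ≡ᵇ (p ∸ 1)) {1} {0}
  ... | inj₁ (full , ε≡1) = inj₂ (ε≡1 , ≡ᵇ⇒≡ _ _ full)
  ... | inj₂ (_ , ε≡0)    = inj₁ ε≡0

  dominant-allele : ∀ k i {Y} → domSearch k i ≡ just Y → Y ≡ A ⊎ Y ≡ B
  dominant-allele zero    i ()
  dominant-allele (suc k) i eq with pairCls i
  dominant-allele (suc k) i refl | clsA = inj₁ refl
  dominant-allele (suc k) i refl | clsB = inj₂ refl
  ... | neut = dominant-allele k (modN (suc i) f) eq

-- The local obstruction behind the lemma, in the arithmetic of one step of the
-- recursion α_{k+1} ≡ p α_k + h_k (mod e).  Here p = p₁ + 1, ν = p w and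
-- e = (p − 1)(ν + 1) (so that e = p^f − 1 when ν = p + … + p^{f−1}).
module Local (p₁ w : ℕ) where
  p ν e : ℕ
  p = suc p₁
  ν = p * w
  e = p₁ * suc ν

  module _ {a b d m : ℕ} (step : p * a + d ≡ b + m * e) (ν<b : ν < b) (d≤ : d ≤ p₁) where

    private
      b≤step : b ≤ p * a + d
      b≤step = subst (b ≤_) (sym step) (m≤m+n b (m * e))

    -- A at position k would force p a + d ≤ ν.
    not-A : ∀ {εf} → p * a < ν + p * εf → εf ≡ 0 ⊎ (εf ≡ 1 × d ≡ 0) → ⊥
    not-A {εf} A-bound εf-cases = <⇒≱ ν<b (≤-trans b≤step (step≤ν εf-cases))
      where
      step≤ν : εf ≡ 0 ⊎ (εf ≡ 1 × d ≡ 0) → p * a + d ≤ ν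
      step≤ν (inj₁ refl) = <⇒≤ (begin-strict
        p * a + d     <⟨ +-monoʳ-< (p * a) (s≤s d≤) ⟩
        p * a + p     ≡⟨ trans (+-comm (p * a) p) (sym (*-suc p a)) ⟩
        p * suc a     ≤⟨ *-monoʳ-≤ p (*-cancelˡ-< p a w (subst (p * a <_) ν+p*0≡ν A-bound)) ⟩
        ν             ∎)
        where
        open ≤-Reasoning
        ν+p*0≡ν : ν + p * 0 ≡ ν
        ν+p*0≡ν = trans (cong (λ x → ν + x) (*-zeroʳ p)) (+-identityʳ ν)
      step≤ν (inj₂ (refl , refl)) = begin
        p * a + 0     ≡⟨ +-identityʳ (p * a) ⟩
        p * a         ≤⟨ *-monoʳ-≤ p (ℕ.s≤s⁻¹ (*-cancelˡ-< p a (suc w) (subst (p * a <_) (sym (expand p w)) A-bound))) ⟩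
        ν             ∎
        where
        open ≤-Reasoning
        expand : ∀ x y → x * suc y ≡ x * y + x * 1
        expand = ℕ-Ring.solve-∀

    -- B at position k would force either b ≤ ν (if the step wraps around, m ≥ 1)
    -- or e ≤ b (if it does not, m = 0).
    not-B : ∀ {εk} → p₁ * ν < p * a + p * εk → a ≤ ν → b < e →
            εk ≡ 0 ⊎ (εk ≡ 1 × d ≡ p₁) → ⊥
    not-B {εk} B-lower a≤ν b<e εk-cases = wraps m step
      where
      wraps : ∀ m → p * a + d ≡ b + m * e → ⊥
      wraps (suc m′) eq = <⇒≱ ν<b (+-cancelʳ-≤ e b ν (begin
          b + e                 ≤⟨ +-monoʳ-≤ b (m≤m+n e (m′ * e)) ⟩
          b + suc m′ * e        ≡⟨ sym eq ⟩
          p * a + d             ≤⟨ +-mono-≤ (*-monoʳ-≤ p a≤ν) d≤ ⟩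
          p * ν + p₁            ≡⟨ top-digit p₁ ν ⟩
          ν + e                 ∎))
          where
          open ≤-Reasoning
          top-digit : ∀ p₁ ν → suc p₁ * ν + p₁ ≡ ν + p₁ * suc ν
          top-digit = ℕ-Ring.solve-∀
      wraps zero eq = <⇒≱ b<e (ℕ.s≤s⁻¹ (begin
          suc e                 ≡⟨ e+1 p₁ w ⟩
          p * suc (p₁ * w)      ≤⟨ *-monoʳ-≤ p (*-cancelˡ-< p (p₁ * w) (a + εk) (subst₂ _<_ (swap p₁ w) (sym (*-distribˡ-+ p a εk)) B-lower)) ⟩
          p * (a + εk)          ≤⟨ bound εk-cases ⟩
          suc b                 ∎))
          where
          open ≤-Reasoning
          e+1 : ∀ p₁ w → suc (p₁ * suc (suc p₁ * w)) ≡ suc p₁ * suc (p₁ * w)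
          e+1 = ℕ-Ring.solve-∀
          swap : ∀ p₁ w → p₁ * (suc p₁ * w) ≡ suc p₁ * (p₁ * w)
          swap = ℕ-Ring.solve-∀
          b≡ : p * a + d ≡ b
          b≡ = trans eq (+-identityʳ b)
          bound : εk ≡ 0 ⊎ (εk ≡ 1 × d ≡ p₁) → p * (a + εk) ≤ suc b
          bound (inj₁ refl) = begin
            p * (a + 0)         ≡⟨ cong (p *_) (+-identityʳ a) ⟩
            p * a               ≤⟨ m≤m+n (p * a) d ⟩
            p * a + d           ≡⟨ b≡ ⟩
            b                   ≤⟨ n≤1+n b ⟩
            suc b               ∎
          bound (inj₂ (refl , refl)) = begin
            p * (a + 1)         ≡⟨ last-digit p₁ a ⟩
            suc (p * a + p₁)    ≡⟨ cong suc b≡ ⟩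
            suc b               ∎
            where
            last-digit : ∀ p₁ a → suc p₁ * (a + 1) ≡ suc (suc p₁ * a + p₁)
            last-digit = ℕ-Ring.solve-∀

module Setting (pp gg : ℕ) (hd α : ℕ → ℕ) (hd≤ : ∀ i → i < suc (suc gg) → hd i ≤ suc pp) where

  p f n : ℕ
  p = suc (suc pp)
  f = suc (suc gg)
  n = f + f

  open Construction p f hd α public
  open Shapes p f hd α public
  open Numeral p public

  idx-small : ∀ {j} → j < n → idx j ≡ j
  idx-small = m<n⇒m%n≡m

  idx<n : ∀ j → idx j < n
  idx<n j = m%n<n j n

  idx-periodic : ∀ j → idx (j + n) ≡ idx j
  idx-periodic j = [m+n]%n≡m%n j n

  hh-cases : ∀ j → (idx j < f × hh j ≡ hd (idx j)) ⊎ (¬ idx j < f × hh j ≡ suc pp ∸ hd (idx j ∸ f))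
  hh-cases j with if-cases (idx j <ᵇ f) {hd (idx j)} {suc pp ∸ hd (idx j ∸ f)}
  ... | inj₁ (lt , eq)  = inj₁ (<ᵇ⇒< _ _ lt , eq)
  ... | inj₂ (¬lt , eq) = inj₂ ((λ lt → ¬lt (<⇒<ᵇ lt)) , eq)

  hh≤ : ∀ j → hh j ≤ suc pp
  hh≤ j with hh-cases j
  ... | inj₁ (lt , eq) = subst (_≤ suc pp) (sym eq) (hd≤ (idx j) lt)
  ... | inj₂ (_ , eq)  = subst (_≤ suc pp) (sym eq) (m∸n≤m (suc pp) (hd (idx j ∸ f)))

  hh-low : ∀ {r} → r < f → hh r ≡ hd r
  hh-low {r} r<f with hh-cases r | idx-small (<-≤-trans r<f (m≤m+n f f))
  ... | inj₁ (_ , eq)  | idx≡ = trans eq (cong hd idx≡)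
  ... | inj₂ (¬lt , _) | idx≡ = contradiction (subst (_< f) (sym idx≡) r<f) ¬lt

  hh-high : ∀ {r} → r < f → hh (f + r) ≡ suc pp ∸ hd r
  hh-high {r} r<f with hh-cases (f + r) | idx-small (+-monoʳ-< f r<f)
  ... | inj₁ (lt , _) | idx≡ = contradiction (m≤m+n f r) (<⇒≱ (subst (_< f) idx≡ lt))
  ... | inj₂ (_ , eq) | idx≡ =
    trans eq (trans (cong (λ k → suc pp ∸ hd (k ∸ f)) idx≡) (cong (λ k → suc pp ∸ hd k) (m+n∸m≡n f r)))

  hh-periodic : ∀ j → hh (j + n) ≡ hh j
  hh-periodic j = cong (λ k → if k <ᵇ f then hd k else suc pp ∸ hd (k ∸ f)) (idx-periodic j)

  hh-complement : ∀ j → j < n → hh j + hh (j + f) ≡ suc pp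
  hh-complement j j<n with j <? f
  ... | yes j<f = begin
    hh j + hh (j + f)         ≡⟨ cong₂ _+_ (hh-low j<f) (trans (cong hh (+-comm j f)) (hh-high j<f)) ⟩
    hd j + (suc pp ∸ hd j)    ≡⟨ m+[n∸m]≡n (hd≤ j j<f) ⟩
    suc pp                    ∎
    where open ≡-Reasoning
  ... | no j≮f with m≤n⇒∃[o]m+o≡n (≮⇒≥ j≮f)
  ...   | r , refl = begin
    hh (f + r) + hh (f + r + f) ≡⟨ cong₂ _+_ (hh-high r<f) (trans (cong hh (rotate f r)) (trans (hh-periodic r) (hh-low r<f))) ⟩
    (suc pp ∸ hd r) + hd r      ≡⟨ m∸n+n≡m (hd≤ r r<f) ⟩
    suc pp                      ∎
    where
    open ≡-Reasoning
    r<f : r < f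
    r<f = +-cancelˡ-< f r f j<n
    rotate : ∀ f r → f + r + f ≡ r + (f + f)
    rotate = ℕ-Ring.solve-∀

  open Geometric (suc pp)

  w q e N : ℕ
  w = sumTo (suc gg) (p ^_)
  q = p ^ f
  e = q ∸ 1
  N = suc q

  ν≡pw : ν ≡ p * w
  ν≡pw = cong (_∸ 1) (sumTo-shift (suc gg))

  e≡ : e ≡ suc pp * suc ν
  e≡ = begin
    p ^ f ∸ 1                        ≡⟨ cong (_∸ 1) (geometric f) ⟨
    suc pp * sumTo f (p ^_)          ≡⟨ cong (suc pp *_) (trans (sumTo-shift (suc gg)) (cong suc (sym ν≡pw))) ⟩
    suc pp * suc ν                   ∎
    where open ≡-Reasoning

  q≡ : q ≡ suc e
  q≡ = trans (sym (geometric f)) (cong (λ x → suc (x ∸ 1)) (geometric f))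

  instance
    e≢0 : NonZero e
    e≢0 = ℕ.>-nonZero (subst (0 <_) (sym e≡) z<s)

  S C D : ℕ
  S = numeral hh f
  C = numeral (λ i → hh (f + i)) f
  D = numeral hh n

  S<q : S < q
  S<q = numeral-bound hh f (λ i _ → s≤s (hh≤ i))

  S+C≡e : S + C ≡ e
  S+C≡e = suc-injective (trans (numeral-complement hh (λ i → hh (f + i)) f complementary) q≡)
    where
    complementary : ∀ i → i < f → suc (hh i + hh (f + i)) ≡ p
    complementary i i<f = cong suc (trans (cong (λ k → hh i + hh k) (+-comm f i))
                                          (hh-complement i (<-≤-trans i<f (m≤m+n f f))))

  -- The period D equals (1 + S)(p^f − 1), i.e. (1 + S)/(p^f + 1) = D/(p^{2f} − 1).
  D≡ : D ≡ suc S * e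
  D≡ = begin
    D                     ≡⟨ numeral-split hh f f ⟩
    S * q + C             ≡⟨ cong (λ x → S * x + C) (trans q≡ (cong suc (sym S+C≡e))) ⟩
    S * suc (S + C) + C   ≡⟨ factor S C ⟩
    suc S * (S + C)       ≡⟨ cong (suc S *_) S+C≡e ⟩
    suc S * e             ∎
    where
    open ≡-Reasoning
    factor : ∀ S C → S * suc (S + C) + C ≡ suc S * (S + C)
    factor = ℕ-Ring.solve-∀

  p^n≡ : p ^ n ≡ suc (N * e)
  p^n≡ = begin
    p ^ (f + f)           ≡⟨ ^-distribˡ-+-* p f f ⟩
    q * q                 ≡⟨ cong₂ _*_ q≡ q≡ ⟩
    suc e * suc e         ≡⟨ square e ⟩
    suc (suc (suc e) * e) ≡⟨ cong (λ x → suc (suc x * e)) q≡ ⟨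
    suc (N * e)           ∎
    where
    open ≡-Reasoning
    square : ∀ e → suc e * suc e ≡ suc (suc (suc e) * e)
    square = ℕ-Ring.solve-∀

  instance
    Ne≢0 : NonZero (N * e)
    Ne≢0 = m*n≢0 N e

  -- Multiplying
  -- by e, p^j D = P·(p^{2f} − 1) + (P + p^j L) where P, L are the blocks of D before
  -- and after digit j, and the rotated numeral P + p^j L stays below p^{2f} − 1.
  floor-digits : ∀ j → j ≤ n → (p ^ j * suc S) / N ≡ numeral hh j
  floor-digits j j≤n with m≤n⇒∃[o]m+o≡n j≤n
  ... | m , j+m≡n = begin
    (p ^ j * suc S) / N                 ≡⟨ m*n/o*n≡m/o (p ^ j * suc S) e N ⟨
    (p ^ j * suc S * e) / (N * e)       ≡⟨ /-congˡ decomposition ⟩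
    (rotated + P * (N * e)) / (N * e)   ≡⟨ quotient-unique rotated P rotated<Ne ⟩
    P                                   ∎
    where
    open ≡-Reasoning
    P L rotated : ℕ
    P = numeral hh j
    L = numeral (λ i → hh (j + i)) m
    rotated = P + p ^ j * L
    D-split : D ≡ P * p ^ m + L
    D-split = subst (λ k → numeral hh k ≡ P * p ^ m + L) j+m≡n (numeral-split hh j m)
    p^n-split : p ^ j * p ^ m ≡ suc (N * e)
    p^n-split = trans (sym (^-distribˡ-+-* p j m)) (trans (cong (p ^_) j+m≡n) p^n≡)
    decomposition : p ^ j * suc S * e ≡ rotated + P * (N * e)
    decomposition = begin
      p ^ j * suc S * e                 ≡⟨ trans (*-assoc (p ^ j) (suc S) e) (cong (p ^ j *_) (sym D≡)) ⟩
      p ^ j * D                         ≡⟨ cong (p ^ j *_) D-split ⟩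
      p ^ j * (P * p ^ m + L)           ≡⟨ expand (p ^ j) P (p ^ m) L ⟩
      P * (p ^ j * p ^ m) + p ^ j * L   ≡⟨ cong (λ x → P * x + p ^ j * L) p^n-split ⟩
      P * suc (N * e) + p ^ j * L       ≡⟨ collect P (N * e) (p ^ j * L) ⟩
      rotated + P * (N * e)             ∎
      where
      expand : ∀ x P y L → x * (P * y + L) ≡ P * (x * y) + x * L
      expand = ℕ-Ring.solve-∀
      collect : ∀ P M R → P * suc M + R ≡ P + R + P * M
      collect = ℕ-Ring.solve-∀
    D<Ne : D < N * e
    D<Ne = subst (_< N * e) (sym D≡) (*-monoˡ-< e (s≤s S<q))
    rotated<Ne : rotated < N * e
    rotated<Ne = ℕ.s<s⁻¹ (subst (suc rotated <_) p^n-split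
      (swap-not-max (numeral-bound hh j (λ i _ → s≤s (hh≤ i)))
                    (numeral-bound (λ i → hh (j + i)) m (λ i _ → s≤s (hh≤ (j + i))))
                    (subst (λ x → suc x < p ^ j * p ^ m) D-split (subst (suc D <_) (sym p^n-split) (s≤s D<Ne)))))

  digit-sum : ℕ
  digit-sum = sumTo f (λ i → hd i * p ^ (f ∸ 1 ∸ i))

  sum≡S : digit-sum ≡ S
  sum≡S = begin
    digit-sum                              ≡⟨ numeral-as-sum hd f f ≤-refl ⟩
    numeral hd f * p ^ (f ∸ f)             ≡⟨ cong (λ x → numeral hd f * p ^ x) (n∸n≡0 f) ⟩
    numeral hd f * 1                       ≡⟨ *-identityʳ _ ⟩
    numeral hd f                           ≡⟨ numeral-cong f (λ i i<f → sym (hh-low i<f)) ⟩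
    S                                      ∎
    where open ≡-Reasoning

  module Floors (h γ t : ℤ) (h≡ : h ≡ + suc S ℤ.+ t ℤ.* + N) where

    floor-h : ∀ j → j ≤ n → (+ (p ^ j) ℤ.* h) /ℕ N ≡ + numeral hh j ℤ.+ + (p ^ j) ℤ.* t
    floor-h j j≤n = proj₂ (divmod-unique N _ R (+ P ℤ.+ + (p ^ j) ℤ.* t) (m%n<n (p ^ j * suc S) N) decomposition)
      where
      P R : ℕ
      P = numeral hh j
      R = (p ^ j * suc S) % N
      euclid : + (p ^ j) ℤ.* + suc S ≡ + R ℤ.+ + P ℤ.* + N
      euclid = begin
        + (p ^ j) ℤ.* + suc S   ≡⟨ ℤP.pos-* (p ^ j) (suc S) ⟨
        + (p ^ j * suc S)       ≡⟨ cong +_ (trans (m≡m%n+[m/n]*n (p ^ j * suc S) N) (cong (λ x → R + x * N) (floor-digits j j≤n))) ⟩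
        + (R + P * N)           ≡⟨ trans (ℤP.pos-+ R (P * N)) (cong (λ x → + R ℤ.+ x) (ℤP.pos-* P N)) ⟩
        + R ℤ.+ + P ℤ.* + N     ∎
        where open ≡-Reasoning
      decomposition : + (p ^ j) ℤ.* h ≡ + R ℤ.+ (+ P ℤ.+ + (p ^ j) ℤ.* t) ℤ.* + N
      decomposition = begin
        + (p ^ j) ℤ.* h                                ≡⟨ cong (+ (p ^ j) ℤ.*_) h≡ ⟩
        + (p ^ j) ℤ.* (+ suc S ℤ.+ t ℤ.* + N)          ≡⟨ distribute (+ (p ^ j)) (+ suc S) t (+ N) ⟩
        + (p ^ j) ℤ.* + suc S ℤ.+ + (p ^ j) ℤ.* t ℤ.* + N ≡⟨ cong (ℤ._+ + (p ^ j) ℤ.* t ℤ.* + N) euclid ⟩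
        + R ℤ.+ + P ℤ.* + N ℤ.+ + (p ^ j) ℤ.* t ℤ.* + N ≡⟨ collect (+ R) (+ P) (+ (p ^ j) ℤ.* t) (+ N) ⟩
        + R ℤ.+ (+ P ℤ.+ + (p ^ j) ℤ.* t) ℤ.* + N      ∎
        where
        open ≡-Reasoning
        distribute : ∀ x s t N → x ℤ.* (s ℤ.+ t ℤ.* N) ≡ x ℤ.* s ℤ.+ x ℤ.* t ℤ.* N
        distribute = ℤ-Ring.solve-∀
        collect : ∀ R P u N → R ℤ.+ P ℤ.* N ℤ.+ u ℤ.* N ≡ R ℤ.+ (P ℤ.+ u) ℤ.* N
        collect = ℤ-Ring.solve-∀

    -- Φ_j = ⌊p^j h/(q + 1)⌋ − p^j γ′, the integer that α_j is congruent to modulo e.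
    Φ : ℕ → ℤ
    Φ j = ((+ (p ^ j) ℤ.* h) /ℕ suc (p ^ f)) ℤ.- + (p ^ j) ℤ.* γ

    Φ≡ : ∀ j → j ≤ n → Φ j ≡ + numeral hh j ℤ.+ + (p ^ j) ℤ.* (t ℤ.- γ)
    Φ≡ j j≤n = trans (cong (ℤ._- + (p ^ j) ℤ.* γ) (floor-h j j≤n)) (factor (+ numeral hh j) (+ (p ^ j)) t γ)
      where
      factor : ∀ P x t γ → P ℤ.+ x ℤ.* t ℤ.- x ℤ.* γ ≡ P ℤ.+ x ℤ.* (t ℤ.- γ)
      factor = ℤ-Ring.solve-∀

    -- Φ_{j+1} = p Φ_j + h_j: multiplying by p shifts the next digit in.
    Φ-step : ∀ j → j < n → Φ (suc j) ≡ + p ℤ.* Φ j ℤ.+ + hh j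
    Φ-step j j<n = begin
      Φ (suc j)                                                      ≡⟨ Φ≡ (suc j) j<n ⟩
      + (numeral hh j * p + hh j) ℤ.+ + (p * p ^ j) ℤ.* (t ℤ.- γ)     ≡⟨ cong₂ (λ x y → x ℤ.+ y ℤ.* (t ℤ.- γ)) digit (ℤP.pos-* p (p ^ j)) ⟩
      + numeral hh j ℤ.* + p ℤ.+ + hh j ℤ.+ + p ℤ.* + (p ^ j) ℤ.* (t ℤ.- γ) ≡⟨ shift (+ numeral hh j) (+ p) (+ hh j) (+ (p ^ j)) (t ℤ.- γ) ⟩
      + p ℤ.* (+ numeral hh j ℤ.+ + (p ^ j) ℤ.* (t ℤ.- γ)) ℤ.+ + hh j ≡⟨ cong (λ x → + p ℤ.* x ℤ.+ + hh j) (Φ≡ j (<⇒≤ j<n)) ⟨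
      + p ℤ.* Φ j ℤ.+ + hh j                                          ∎
      where
      open ≡-Reasoning
      digit : + (numeral hh j * p + hh j) ≡ + numeral hh j ℤ.* + p ℤ.+ + hh j
      digit = trans (ℤP.pos-+ (numeral hh j * p) (hh j)) (cong (ℤ._+ + hh j) (ℤP.pos-* (numeral hh j) p))
      shift : ∀ P p d x u → P ℤ.* p ℤ.+ d ℤ.+ p ℤ.* x ℤ.* u ≡ p ℤ.* (P ℤ.+ x ℤ.* u) ℤ.+ d
      shift = ℤ-Ring.solve-∀

    -- Φ is 2f-periodic modulo e: Φ_{2f} − Φ_0 = D + (p^{2f} − 1)(t − γ′), a multiple of e.
    Φ-period : + e ∣ₛ Φ 0 ℤ.- Φ n
    Φ-period = divides (ℤ.- (+ suc S ℤ.+ + N ℤ.* (t ℤ.- γ))) (begin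
      Φ 0 ℤ.- Φ n                                                   ≡⟨ cong₂ ℤ._-_ (Φ≡ 0 z≤n) (Φ≡ n ≤-refl) ⟩
      (+ 0 ℤ.+ + 1 ℤ.* (t ℤ.- γ)) ℤ.- (+ D ℤ.+ + (p ^ n) ℤ.* (t ℤ.- γ)) ≡⟨ cong₂ (λ x y → (+ 0 ℤ.+ + 1 ℤ.* (t ℤ.- γ)) ℤ.- (x ℤ.+ y ℤ.* (t ℤ.- γ))) D-cast p^n-cast ⟩
      (+ 0 ℤ.+ + 1 ℤ.* (t ℤ.- γ)) ℤ.- (+ suc S ℤ.* + e ℤ.+ (+ N ℤ.* + e ℤ.+ + 1) ℤ.* (t ℤ.- γ)) ≡⟨ factor (+ suc S) (+ N) (+ e) (t ℤ.- γ) ⟩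
      ℤ.- (+ suc S ℤ.+ + N ℤ.* (t ℤ.- γ)) ℤ.* + e                    ∎)
      where
      open ≡-Reasoning
      D-cast : + D ≡ + suc S ℤ.* + e
      D-cast = trans (cong +_ D≡) (ℤP.pos-* (suc S) e)
      p^n-cast : + (p ^ n) ≡ + N ℤ.* + e ℤ.+ + 1
      p^n-cast = trans (cong +_ (trans p^n≡ (+-comm 1 (N * e)))) (trans (ℤP.pos-+ (N * e) 1) (cong (ℤ._+ + 1) (ℤP.pos-* N e)))
      factor : ∀ s N e u → (+ 0 ℤ.+ + 1 ℤ.* u) ℤ.- (s ℤ.* e ℤ.+ (N ℤ.* e ℤ.+ + 1) ℤ.* u) ≡ ℤ.- (s ℤ.+ N ℤ.* u) ℤ.* e
      factor = ℤ-Ring.solve-∀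

    module Entries (α≡Φ : ∀ i → i < n → + e ∣ₛ + α i ℤ.- Φ i) (α<e : ∀ i → i < n → α i < e) where

      recurrence : ∀ k → k < n → + e ∣ₛ + α (idx (suc k)) ℤ.- + (p * α k + hh k)
      recurrence k k<n = subst (λ x → + e ∣ₛ + α (idx (suc k)) ℤ.- x) (sym step-cast)
        (shift-congruence {a′ = + α (idx (suc k))} {b′ = Φ (idx (suc k))} {a = + α k} {b = Φ k} {d = + hh k} (+ p)
           (α≡Φ (idx (suc k)) (idx<n (suc k))) (α≡Φ k k<n) (Φ-follows (m≤n⇒m<n∨m≡n k<n)))
        where
        step-cast : + (p * α k + hh k) ≡ + p ℤ.* + α k ℤ.+ + hh k
        step-cast = trans (ℤP.pos-+ (p * α k) (hh k)) (cong (ℤ._+ + hh k) (ℤP.pos-* p (α k)))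
        Φ-follows : suc k < n ⊎ suc k ≡ n → + e ∣ₛ Φ (idx (suc k)) ℤ.- (+ p ℤ.* Φ k ℤ.+ + hh k)
        Φ-follows (inj₁ k+1<n) = divides (+ 0) (begin
          Φ (idx (suc k)) ℤ.- (+ p ℤ.* Φ k ℤ.+ + hh k) ≡⟨ cong₂ (λ x y → Φ x ℤ.- y) (idx-small k+1<n) (sym (Φ-step k k<n)) ⟩
          Φ (suc k) ℤ.- Φ (suc k)                      ≡⟨ ℤP.+-inverseʳ (Φ (suc k)) ⟩
          + 0                                          ∎)
          where open ≡-Reasoning
        Φ-follows (inj₂ refl) = subst (λ x → + e ∣ₛ Φ (idx n) ℤ.- x) (Φ-step k k<n)
          (subst (λ j → + e ∣ₛ Φ j ℤ.- Φ n) (sym (idx-periodic 0)) Φ-period)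

      step : ∀ k → k < n → ∃[ m ] p * α k + hh k ≡ α (idx (suc k)) + m * e
      step k k<n = congruent-above (α<e (idx (suc k)) (idx<n (suc k))) (recurrence k k<n)

      -- An entry 0 of X cannot follow an entry A or B: apply the one-step estimate to
      -- a = α_k, b = α_{k+1}, using h_k = 0 when ε_{k+f} = 1 and h_k = p − 1 when ε_k = 1.
      O-blocks-predecessor : ∀ k → k < n → X (idx (suc k)) ≡ O → X k ≡ A ⊎ X k ≡ B → ⊥
      O-blocks-predecessor k k<n X′≡O = blocked
        where
        open Local (suc pp) w using (not-A; not-B)
        k′ = idx (suc k)
        m = proj₁ (step k k<n)
        e≡local : e ≡ suc pp * suc (p * w)
        e≡local = trans e≡ (cong (λ x → suc pp * suc x) ν≡pw)
        step-local : p * α k + hh k ≡ α k′ + m * (suc pp * suc (p * w))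
        step-local = subst (λ x → p * α k + hh k ≡ α k′ + m * x) e≡local (proj₂ (step k k<n))
        αx≡ : ∀ {j} → j < n → αx j ≡ α j
        αx≡ j<n = cong α (idx-small j<n)
        ν<b : p * w < α k′
        ν<b = subst₂ _<_ ν≡pw (αx≡ (idx<n (suc k))) (X≡O⇒ k′ X′≡O)
        blocked : X k ≡ A ⊎ X k ≡ B → ⊥
        blocked (inj₁ X≡A) = not-A {a = α k} {b = α k′} {d = hh k} {m = m} step-local ν<b (hh≤ k)
          (subst₂ (λ a ν′ → p * a < ν′ + p * ε (k + f)) (αx≡ k<n) ν≡pw (X≡A⇒ k X≡A)) εf-cases
          where
          εf-cases : ε (k + f) ≡ 0 ⊎ (ε (k + f) ≡ 1 × hh k ≡ 0)
          εf-cases with ε-cases (k + f)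
          ... | inj₁ ε≡0          = inj₁ ε≡0
          ... | inj₂ (ε≡1 , full) = inj₂ (ε≡1 , +-cancelʳ-≡ (suc pp) (hh k) 0
                                           (trans (cong (λ x → hh k + x) (sym full)) (hh-complement k k<n)))
        blocked (inj₂ X≡B) with X≡B⇒ k X≡B
        ... | B-lower , B-upper = not-B {a = α k} {b = α k′} {d = hh k} {m = m} step-local ν<b (hh≤ k)
          (subst₂ (λ ν′ a → suc pp * ν′ < p * a + p * ε k) ν≡pw (αx≡ k<n) B-lower)
          (subst₂ _≤_ (αx≡ k<n) ν≡pw B-upper)
          (subst (α k′ <_) e≡local (α<e k′ (idx<n (suc k))))
          (ε-cases k)

  idx⇒∣ : ∀ x u → idxℤ x ≡ idx u → + n ∣ₛ x ℤ.- + u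
  idx⇒∣ = same-residue⇒∣ n

  ∣⇒idx : ∀ x u → + n ∣ₛ x ℤ.- + u → idxℤ x ≡ idx u
  ∣⇒idx = ∣⇒same-residue n

  -- x + f ≡ u and x − 1 ≡ v (mod 2f) are impossible when v + f ≡ u + 1 (mod 2f): the
  -- difference of the two congruences would make 2f divide 2.
  misaligned : ∀ x u v c → idxℤ (x ℤ.+ + f) ≡ idx u → idxℤ (x ℤ.- + 1) ≡ idx v →
               v + f ≡ suc u + c * n → ⊥
  misaligned x u v c at-u at-v v+f≡ = <⇒≱ 2<n (ℕ∣.∣⇒≤ (∣⇒∣ᵤ n∣2))
    where
    2<n : 2 < n
    2<n = s≤s (s≤s (≤-trans (s≤s z≤n) (m≤n+m (suc (suc gg)) gg)))
    distance : ∀ x F U V → ((x ℤ.+ F) ℤ.- U) ℤ.- ((x ℤ.- + 1) ℤ.- V) ≡ (V ℤ.+ F) ℤ.- U ℤ.+ + 1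
    distance = ℤ-Ring.solve-∀
    two-more : ∀ U C N → (+ 1 ℤ.+ U ℤ.+ C ℤ.* N) ℤ.- U ℤ.+ + 1 ≡ + 2 ℤ.+ C ℤ.* N
    two-more = ℤ-Ring.solve-∀
    v+f-cast : + v ℤ.+ + f ≡ + 1 ℤ.+ + u ℤ.+ + c ℤ.* + n
    v+f-cast = trans (sym (ℤP.pos-+ v f)) (trans (cong +_ v+f≡) (trans (ℤP.pos-+ (suc u) (c * n)) (cong (λ z → + suc u ℤ.+ z) (ℤP.pos-* c n))))
    n∣2+cn : + n ∣ₛ + 2 ℤ.+ + c ℤ.* + n
    n∣2+cn = subst (+ n ∣ₛ_)
      (trans (distance x (+ f) (+ u) (+ v)) (trans (cong (λ z → z ℤ.- + u ℤ.+ + 1) v+f-cast) (two-more (+ u) (+ c) (+ n))))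
      (∣m∣n⇒∣m-n (idx⇒∣ (x ℤ.+ + f) u at-u) (idx⇒∣ (x ℤ.- + 1) v at-v))
    n∣2 : + n ∣ₛ + 2
    n∣2 = ∣m+n∣n⇒∣m n∣2+cn (divides (+ c) refl)

  carries : ∀ j {Y Z} → dom j ≡ just Y → Z ≡ Y → Z ≡ A ⊎ Z ≡ B
  carries j dom≡Y refl = dominant-allele f _ dom≡Y

  link-from-predecessor : ∀ x → Linked (x ℤ.+ + f) (x ℤ.- + 1) →
                          ∃[ k ] k < n × idxℤ (x ℤ.- + 1) ≡ idx k × (X k ≡ A ⊎ X k ≡ B)
  link-from-predecessor x (_ , j , j<f , _ , dom≡Y , _ , inj₁ (X≡Y , inj₁ (at-j , at-j+1+f))) =
    ⊥-elim (misaligned x j (suc j + f) 1 at-j at-j+1+f (wrap j f))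
    where
    wrap : ∀ j f → suc j + f + f ≡ suc j + 1 * (f + f)
    wrap = ℕ-Ring.solve-∀
  link-from-predecessor x (_ , j , j<f , _ , dom≡Y , _ , inj₁ (X≡Y , inj₂ (_ , at-j))) =
    j , <-≤-trans j<f (m≤m+n f f) , at-j , carries j dom≡Y X≡Y
  link-from-predecessor x (_ , j , j<f , _ , dom≡Y , _ , inj₂ (X≡Y , inj₁ (at-j+f , at-j+1))) =
    ⊥-elim (misaligned x (j + f) (suc j) 0 at-j+f at-j+1 (sym (+-identityʳ (suc j + f))))
  link-from-predecessor x (_ , j , j<f , _ , dom≡Y , _ , inj₂ (X≡Y , inj₂ (_ , at-j+f))) =
    j + f , +-monoˡ-< f j<f , at-j+f , carries j dom≡Y X≡Y

  successor : ∀ x k → idxℤ (x ℤ.- + 1) ≡ idx k → idxℤ x ≡ idx (suc k)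
  successor x k at-k = ∣⇒idx x (suc k) (subst (+ n ∣ₛ_) (shift x (+ k)) (idx⇒∣ (x ℤ.- + 1) k at-k))
    where
    shift : ∀ x k → (x ℤ.- + 1) ℤ.- k ≡ x ℤ.- (+ 1 ℤ.+ k)
    shift = ℤ-Ring.solve-∀

  below-e : ∀ {x} → x ≤ e ∸ 1 → x < e
  below-e {x} x≤ = subst (x ℕ.<_) (trans (+-comm 1 (e ∸ 1)) (m∸n+n≡m (ℕ.>-nonZero⁻¹ e))) (s≤s x≤)

  h-decomposition : ∀ h → + N ∣ (h - (+ 1 ℤ.+ + digit-sum)) →
                    Σ ℤ λ t → h ≡ + suc S ℤ.+ t ℤ.* + N
  h-decomposition h N∣ = decompose (∣ᵤ⇒∣ N∣)
    where
    unshift : ∀ h s → h ≡ s ℤ.+ (h - s)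
    unshift = ℤ-Ring.solve-∀
    decompose : + N ∣ₛ (h - (+ 1 ℤ.+ + digit-sum)) →
                Σ ℤ λ t → h ≡ + suc S ℤ.+ t ℤ.* + N
    decompose (divides t h-s≡) =
      t , trans (unshift h (+ 1 ℤ.+ + digit-sum)) (cong₂ (λ s u → + 1 ℤ.+ + s ℤ.+ u) sum≡S h-s≡)

  no-link : ∀ h γ′ → + N ∣ (h - (+ 1 ℤ.+ + digit-sum)) →
    (∀ i → i < n → (α i ≤ e ∸ 1) × (+ e ∣ (+ α i - (((+ (p ^ i) ℤ.* h) /ℕ N) - + (p ^ i) ℤ.* γ′)))) →
    ∀ x → X (idxℤ x) ≡ O → ¬ Linked (x ℤ.+ + f) (x - + 1)
  no-link h γ′ N∣ α-hyp x Xx≡O link with h-decomposition h N∣ | link-from-predecessor x link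
  ... | t , h≡ | k , k<n , at-k , dominant =
    O-blocks-predecessor k k<n (subst (λ j → X j ≡ O) (successor x k at-k) Xx≡O) dominant
    where
    open Floors h γ′ t h≡
    open Entries (λ i i<n → ∣ᵤ⇒∣ (proj₂ (α-hyp i i<n))) (λ i i<n → below-e (proj₁ (α-hyp i i<n)))

lemma4p1p2 : (p f : ℕ) → Prime p → 2 ≤ f →
    (h γ′ : ℤ) → ¬ (+ (suc (p ^ f)) ∣ h) →
    (hd : ℕ → ℕ) → (∀ i → i < f → hd i ≤ p ∸ 1) →
    (+ (suc (p ^ f)) ∣ (h - (+ 1 ℤ.+ + sumTo f (λ i → hd i ℕ.* p ^ (f ∸ 1 ∸ i))))) →
    (α : ℕ → ℕ) →
    (∀ i → i < f ℕ.+ f →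
       (α i ≤ p ^ f ∸ 1 ∸ 1) ×
       (+ (p ^ f ∸ 1) ∣ (+ α i - (((+ (p ^ i) ℤ.* h) /ℕ suc (p ^ f)) - + (p ^ i) ℤ.* γ′)))) →
    (i : ℤ) →
    Construction.X p f hd α (Construction.idxℤ p f hd α i) ≡ O →
    ¬ Construction.Linked p f hd α (i ℤ.+ + f) (i - + 1)
lemma4p1p2 p f p-prime 2≤f h γ′ _ hd hd≤ N∣h-digits α α-hyp i Xi≡O
  with nonTrivial⇒n>1 p {{prime⇒nonTrivial p-prime}} | 2≤f
... | s≤s (s≤s {n = pp} _) | s≤s (s≤s {n = gg} _) = Setting.no-link pp gg hd α hd≤ h γ′ N∣h-digits α-hyp i Xi≡O
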